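{- Let $2k+1$ be a prime and let $n$ be a positive integer with $n\equiv 0\pmod{4k+2}$. Let $a_1,a_2,\dots,a_{2k+1}$ be positive integers with $1\le a_1<a_2<\dots<a_{2k+1}<\frac{n}{2}$, and suppose there is $p\in\{1,2,\dots,2k\}$ such that $a_{i+1}-a_i\equiv p\pmod{2k+1}$ for all $i=1,\dots,2k$. Then the circulant graph $C_n(a_1,a_2,\dots,a_{2k+1})$ admits a $(2k+1)$-neighborhood balanced coloring.
   Context: For a prime $2k+1$ (with $k\ge 1$), a $(2k+1)$-neighborhood balanced coloring of a finite simple graph is an assignment to each vertex of one of $2k+1$ colors $R_1,\dots,R_{2k+1}$ such that every vertex has an equal number of neighbors of each color. The circulant graph $C_n(a_1,\dots,a_m)$ has vertex set $\mathbb{Z}_n$, with $u$ adjacent to $u\pm a_i \pmod n$ for each $i=1,\dots,m$. -}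

module Defs where

open import Data.Nat using (ℕ; zero; suc; _+_; _*_; _∸_; _<_; _≤_; NonZero; _≡ᵇ_)
open import Data.Nat.DivMod using (_%_)
open import Data.Bool using (Bool; true; false; _∨_)
open import Data.Fin using (Fin; toℕ)
open import Data.List using (List; length; filter)
open import Data.Bool.ListAction using (any)
open import Data.List as L using ()
open import Data.Fin using (Fin)
open import Data.Fin.Base using ()
open import Data.List.Base using ()
open import Data.Vec.Functional using ()
open import Relation.Binary.PropositionalEquality using (_≡_)
open import Data.Bool using (T)
open import Relation.Nullary.Decidable using (Dec)
open import Data.Bool.Properties using (T?)
import Data.List.Base
open import Data.Fin.Base using () renaming (Fin to Fin′)

allFin : (m : ℕ) → List (Fin m)
allFin m = Data.List.Base.tabulate (λ i → i)

-- Circulant graph C_n(a_1,...,a_m) on vertex set ℤ_n ≅ Fin n, with jumps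
-- given by a : Fin m → ℕ : u ~ v  iff  v ≡ u + a_i (mod n) or v ≡ u - a_i (mod n)
-- for some i.  (v ≡ u - a_i  is expressed as  u ≡ v + a_i (mod n).)
circAdj : (n : ℕ) .{{_ : NonZero n}} {m : ℕ} → (Fin m → ℕ) → Fin n → Fin n → Bool
circAdj n {m} a u v =
  any (λ i → (((toℕ u + a i) % n) ≡ᵇ toℕ v) ∨ (((toℕ v + a i) % n) ≡ᵇ toℕ u)) (allFin m)

nbrCount : (n : ℕ) .{{_ : NonZero n}} {m : ℕ} (a : Fin m → ℕ) {r : ℕ}
           (col : Fin n → Fin r) → Fin n → Fin r → ℕ
nbrCount n a {r} col u c =
  length (filter (λ v → T? (circAdj n a u v)) (filter (λ v → col v Data.Fin.≟ c) (allFin n)))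

IsNBColoring : (n : ℕ) .{{_ : NonZero n}} {m : ℕ} (a : Fin m → ℕ) (r : ℕ)
               (col : Fin n → Fin r) → Set
IsNBColoring n a r col = ∀ u (c c′ : Fin r) → nbrCount n a col u c ≡ nbrCount n a col u c′

AdmitsNBColoring : (n : ℕ) .{{_ : NonZero n}} {m : ℕ} (a : Fin m → ℕ) (r : ℕ) → Set
AdmitsNBColoring n a r = Data.Product.Σ (Fin n → Fin r) (IsNBColoring n a r)
  where import Data.Product

-- Colour each vertex v of C_n(a_1,...,a_q), q = 2k+1, by its residue v mod q; this is well defined
-- on ℤ_n because q ∣ n. Since the differences a_{i+1} - a_i are all ≡ p and p is invertible modulo
-- the prime q, the jumps a_i run through every residue modulo q exactly once. Hence among the q
-- neighbours u + a_i each colour occurs exactly once, and likewise among the q neighbours u - a_i.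
-- As 0 < a_i + a_j < n these 2q neighbours are distinct, so every colour occurs exactly twice.
module Submission where

open import Defs
open import Data.Nat using (ℕ; suc; _+_; _*_; _∸_; _<_; _≤_; NonZero)
open import Data.Nat.DivMod using (_%_)
open import Data.Nat.Divisibility using (_∣_)
open import Data.Nat.Primality using (Prime)
open import Data.Fin using (Fin; inject₁) renaming (suc to fsuc; _<_ to _<ᶠ_)
open import Relation.Binary.PropositionalEquality using (_≡_)

open import Data.Nat using (s≤s; >-nonZero; >-nonZero⁻¹)
open import Data.Nat.Properties
  using ( +-comm; +-assoc; +-identityʳ; +-suc; *-comm; *-distribˡ-+; *-distribʳ-+; m+[n∸m]≡n
        ; m∸n+n≡m; m+n≡0⇒m≡0; ≤-refl; ≤-trans; ≤-<-trans; <⇒≤; <⇒≱; >⇒≢; <-cmp; n<1+n; m≤m+n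
        ; m∸n≤m; m<n⇒0<n∸m; +-mono-<; *-cancelˡ-<; ≡ᵇ⇒≡; ≡⇒≡ᵇ)
open import Data.Nat.DivMod
  using ( _/_; %-distribˡ-+; m≡m%n+[m/n]*n; m%n≤n; m%n<n; m%n%n≡m%n; [m+n]%n≡m%n; [m+kn]%n≡m%n
        ; m<n⇒m%n≡m; m∣n⇒o%n%m≡o%m)
open import Data.Nat.Divisibility using (divides; m%n≡0⇒n∣m; ∣⇒≤; ∣-trans)
open import Data.Nat.Coprimality using (Coprime; coprime-divisor; prime⇒coprime)
open import Data.Fin using (fromℕ<; toℕ; punchOut; _≟_) renaming (zero to fzero)
open import Data.Fin.Properties
  using (any?; toℕ-fromℕ<; toℕ-injective; toℕ<n; 0≢1+n; punchOut-injective; <⇒notInjective; ≤̄⇒inject₁<)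
  renaming (suc-injective to fsuc-injective)
open import Data.Nat.Tactic.RingSolver using (solve-∀)
open import Data.Product using (∃-syntax; _×_; _,_; proj₁; proj₂)
open import Data.Sum using (_⊎_; inj₁; inj₂; [_,_]′)
import Data.Sum as Sum
open import Data.Bool using (T)
open import Data.Bool.Properties using (T?; T-∨)
open import Data.List using (List; []; _∷_; length; filter; tabulate)
open import Data.List.Properties using (filter-accept; filter-reject; filter-none)
import Data.List.Relation.Unary.All.Properties as All
import Data.List.Relation.Unary.Any.Properties as Any
open import Data.Empty using (⊥-elim)
open import Function using (_∘_; id; Injective; Equivalence)
open import Relation.Nullary using (yes; no; contradiction)
open import Relation.Unary using (Pred; Decidable)
open import Relation.Binary using (DecidableEquality; tri<; tri≈; tri>)
open import Relation.Binary.PropositionalEquality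
  using (_≢_; refl; sym; trans; cong; cong₂; subst₂; module ≡-Reasoning)

module _ {d : ℕ} .{{_ : NonZero d}} where
  open ≡-Reasoning

  +-congˡ-mod : ∀ {x y} z → x % d ≡ y % d → (x + z) % d ≡ (y + z) % d
  +-congˡ-mod {x} {y} z x≡y = begin
    (x + z) % d           ≡⟨ %-distribˡ-+ x z d ⟩
    (x % d + z % d) % d   ≡⟨ cong (λ t → (t + z % d) % d) x≡y ⟩
    (y % d + z % d) % d   ≡⟨ %-distribˡ-+ y z d ⟨
    (y + z) % d           ∎

  +-congʳ-mod : ∀ {x y} z → x % d ≡ y % d → (z + x) % d ≡ (z + y) % d
  +-congʳ-mod {x} {y} z x≡y = begin
    (z + x) % d  ≡⟨ cong (_% d) (+-comm z x) ⟩
    (x + z) % d  ≡⟨ +-congˡ-mod z x≡y ⟩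
    (y + z) % d  ≡⟨ cong (_% d) (+-comm y z) ⟩
    (z + y) % d  ∎

  -- Adding d ∸ m % d undoes adding m, which is how cancellation modulo d is proved.
  m+[d∸m%d]≡[1+m/d]*d : ∀ m → m + (d ∸ m % d) ≡ suc (m / d) * d
  m+[d∸m%d]≡[1+m/d]*d m = begin
    m + (d ∸ m % d)                    ≡⟨ cong (_+ (d ∸ m % d)) (m≡m%n+[m/n]*n m d) ⟩
    m % d + m / d * d + (d ∸ m % d)    ≡⟨ cong (_+ (d ∸ m % d)) (+-comm (m % d) (m / d * d)) ⟩
    m / d * d + m % d + (d ∸ m % d)    ≡⟨ +-assoc (m / d * d) (m % d) (d ∸ m % d) ⟩
    m / d * d + (m % d + (d ∸ m % d))  ≡⟨ cong (m / d * d +_) (m+[n∸m]≡n (m%n≤n m d)) ⟩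
    m / d * d + d                      ≡⟨ +-comm (m / d * d) d ⟩
    suc (m / d) * d                    ∎

  +-cancelʳ-mod : ∀ {x y} z → (x + z) % d ≡ (y + z) % d → x % d ≡ y % d
  +-cancelʳ-mod {x} {y} z x+z≡y+z = begin
    x % d                      ≡⟨ undo x ⟨
    (x + z + (d ∸ z % d)) % d  ≡⟨ +-congˡ-mod (d ∸ z % d) x+z≡y+z ⟩
    (y + z + (d ∸ z % d)) % d  ≡⟨ undo y ⟩
    y % d                      ∎
    where
    undo : ∀ w → (w + z + (d ∸ z % d)) % d ≡ w % d
    undo w = begin
      (w + z + (d ∸ z % d)) % d    ≡⟨ cong (_% d) (+-assoc w z (d ∸ z % d)) ⟩
      (w + (z + (d ∸ z % d))) % d  ≡⟨ cong (λ t → (w + t) % d) (m+[d∸m%d]≡[1+m/d]*d z) ⟩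
      (w + suc (z / d) * d) % d    ≡⟨ [m+kn]%n≡m%n w (suc (z / d)) d ⟩
      w % d                        ∎

  +-cancelˡ-mod : ∀ {x y} z → (z + x) % d ≡ (z + y) % d → x % d ≡ y % d
  +-cancelˡ-mod {x} {y} z z+x≡z+y =
    +-cancelʳ-mod z (trans (cong (_% d) (+-comm x z)) (trans z+x≡z+y (cong (_% d) (+-comm z y))))

  [[m+[d∸o]]%d+o]%d≡m%d : ∀ m {o} → o ≤ d → ((m + (d ∸ o)) % d + o) % d ≡ m % d
  [[m+[d∸o]]%d+o]%d≡m%d m {o} o≤d = begin
    ((m + (d ∸ o)) % d + o) % d  ≡⟨ +-congˡ-mod o (m%n%n≡m%n (m + (d ∸ o)) d) ⟩
    (m + (d ∸ o) + o) % d        ≡⟨ cong (_% d) (+-assoc m (d ∸ o) o) ⟩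
    (m + (d ∸ o + o)) % d        ≡⟨ cong (λ t → (m + t) % d) (m∸n+n≡m o≤d) ⟩
    (m + d) % d                  ≡⟨ [m+n]%n≡m%n m d ⟩
    m % d                        ∎

injective⇒surjective : ∀ {m} {f : Fin m → Fin m} → Injective _≡_ _≡_ f → ∀ c → ∃[ i ] f i ≡ c
injective⇒surjective {suc m} {f} f-inj c with any? (λ i → f i ≟ c)
... | yes hit = hit
... | no miss = ⊥-elim (<⇒notInjective (n<1+n m) punched-injective)
  where
  f≢c : ∀ i → f i ≢ c
  f≢c i fi≡c = miss (i , fi≡c)

  punched-injective : Injective _≡_ _≡_ (λ i → punchOut (f≢c i ∘ sym))
  punched-injective eq = f-inj (punchOut-injective (f≢c _ ∘ sym) (f≢c _ ∘ sym) eq)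

module _ {A : Set} (_≟ᴬ_ : DecidableEquality A) where

  multiplicity : A → List A → ℕ
  multiplicity z xs = length (filter (_≟ᴬ z) xs)

  multiplicity-tabulate : ∀ {n} {f : Fin n → A} → Injective _≡_ _≡_ f →
                          ∀ i → multiplicity (f i) (tabulate f) ≡ 1
  multiplicity-tabulate {f = f} f-inj fzero = trans
    (cong length (filter-accept (_≟ᴬ f fzero) refl))
    (cong (suc ∘ length) (filter-none (_≟ᴬ f fzero)
      (All.tabulate⁺ {f = f ∘ fsuc} (λ j → 0≢1+n ∘ sym ∘ f-inj))))
  multiplicity-tabulate {f = f} f-inj (fsuc i) = trans
    (cong length (filter-reject (_≟ᴬ f (fsuc i)) (0≢1+n ∘ f-inj)))
    (multiplicity-tabulate (fsuc-injective ∘ f-inj) i)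

  length-filter-filter≡multiplicity+multiplicity :
    ∀ {p q} {P : Pred A p} {Q : Pred A q} (P? : Decidable P) (Q? : Decidable Q) {x y : A} →
    x ≢ y → P x × Q x → P y × Q y → (∀ v → P v → Q v → v ≡ x ⊎ v ≡ y) →
    ∀ xs → length (filter P? (filter Q? xs)) ≡ multiplicity x xs + multiplicity y xs
  length-filter-filter≡multiplicity+multiplicity P? Q? {x} {y} x≢y (Px , Qx) (Py , Qy) only = go
    where
    go : ∀ xs → length (filter P? (filter Q? xs)) ≡ multiplicity x xs + multiplicity y xs
    go [] = refl
    go (v ∷ vs) with v ≟ᴬ x | v ≟ᴬ y
    ... | yes refl | yes refl = contradiction refl x≢y
    ... | yes refl | no _ with Q? v
    ...   | no ¬Qx = contradiction Qx ¬Qx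
    ...   | yes _ with P? v
    ...     | no ¬Px = contradiction Px ¬Px
    ...     | yes _ = cong suc (go vs)
    go (v ∷ vs) | no _ | yes refl with Q? v
    ...   | no ¬Qy = contradiction Qy ¬Qy
    ...   | yes _ with P? v
    ...     | no ¬Py = contradiction Py ¬Py
    ...     | yes _ = trans (cong suc (go vs)) (sym (+-suc _ _))
    go (v ∷ vs) | no v≢x | no v≢y with Q? v
    ...   | no _ = go vs
    ...   | yes Qv with P? v
    ...     | no _ = go vs
    ...     | yes Pv = contradiction (only v Pv Qv) [ v≢x , v≢y ]′

module _ (n : ℕ) .{{_ : NonZero n}} {m : ℕ} (a : Fin m → ℕ) (u v : Fin n) where

  Jump : Fin m → Set
  Jump i = (toℕ u + a i) % n ≡ toℕ v ⊎ (toℕ v + a i) % n ≡ toℕ u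

  circAdj⁺ : ∀ i → Jump i → T (circAdj n a u v)
  circAdj⁺ i jump = Any.any⁺ _ (Any.tabulate⁺ i (Equivalence.from T-∨
    (Sum.map (≡⇒≡ᵇ _ _) (≡⇒≡ᵇ _ _) jump)))

  circAdj⁻ : T (circAdj n a u v) → ∃[ i ] Jump i
  circAdj⁻ adj with i , jump ← Any.tabulate⁻ (Any.any⁻ _ _ adj) =
    i , Sum.map (≡ᵇ⇒≡ _ _) (≡ᵇ⇒≡ _ _) (Equivalence.to T-∨ jump)

module _ {d : ℕ} .{{_ : NonZero d}} {p : ℕ} where
  open ≡-Reasoning

  -- The step condition is read with truncated subtraction, hence the monotonicity hypothesis.
  arithmetic-progression-residue : ∀ {m} (a : Fin (suc m) → ℕ) →
    (∀ i → a (inject₁ i) ≤ a (fsuc i)) → (∀ i → (a (fsuc i) ∸ a (inject₁ i)) % d ≡ p % d) →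
    ∀ i → a i % d ≡ (a fzero + toℕ i * p) % d
  arithmetic-progression-residue a _ _ fzero = cong (_% d) (sym (+-identityʳ (a fzero)))
  arithmetic-progression-residue {suc m} a a-mono steps (fsuc i) = begin
    a (fsuc i) % d                     ≡⟨ cong (_% d) (m+[n∸m]≡n (a-mono i)) ⟨
    (a (inject₁ i) + δ) % d            ≡⟨ +-congˡ-mod δ (arithmetic-progression-residue
                                            (a ∘ inject₁) (a-mono ∘ inject₁) (steps ∘ inject₁) i) ⟩
    (a fzero + toℕ i * p + δ) % d      ≡⟨ +-congʳ-mod (a fzero + toℕ i * p) (steps i) ⟩
    (a fzero + toℕ i * p + p) % d      ≡⟨ cong (_% d) (+-assoc (a fzero) (toℕ i * p) p) ⟩
    (a fzero + (toℕ i * p + p)) % d    ≡⟨ cong (λ t → (a fzero + t) % d) (+-comm (toℕ i * p) p) ⟩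
    (a fzero + toℕ (fsuc i) * p) % d   ∎
    where δ = a (fsuc i) ∸ a (inject₁ i)

  multiple-residues-distinct : Coprime d p → ∀ b {i j} → i < j → j < d →
                               (b + i * p) % d ≢ (b + j * p) % d
  multiple-residues-distinct d⊥p b {i} {j} i<j j<d eq =
    <⇒≱ (≤-<-trans (m∸n≤m j i) j<d) (∣⇒≤ {{>-nonZero (m<n⇒0<n∸m i<j)}} d∣e)
    where
    e = j ∸ i
    j*p≡i*p+p*e : b + j * p ≡ b + i * p + p * e
    j*p≡i*p+p*e = begin
      b + j * p            ≡⟨ cong (λ t → b + t * p) (m+[n∸m]≡n (<⇒≤ i<j)) ⟨
      b + (i + e) * p      ≡⟨ cong (b +_) (*-distribʳ-+ p i e) ⟩
      b + (i * p + e * p)  ≡⟨ +-assoc b (i * p) (e * p) ⟨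
      b + i * p + e * p    ≡⟨ cong (b + i * p +_) (*-comm e p) ⟩
      b + i * p + p * e    ∎
    p*e%d≡0 : p * e % d ≡ 0
    p*e%d≡0 = begin
      p * e % d  ≡⟨ +-cancelˡ-mod {d = d} (b + i * p) (begin
        (b + i * p + 0) % d      ≡⟨ cong (_% d) (+-identityʳ (b + i * p)) ⟩
        (b + i * p) % d          ≡⟨ eq ⟩
        (b + j * p) % d          ≡⟨ cong (_% d) j*p≡i*p+p*e ⟩
        (b + i * p + p * e) % d  ∎) ⟨
      0 % d      ≡⟨ m<n⇒m%n≡m (>-nonZero⁻¹ d) ⟩
      0          ∎
    d∣e : d ∣ e
    d∣e = coprime-divisor d⊥p (m%n≡0⇒n∣m (p * e) d p*e%d≡0)

  multiple-residues-injective : Coprime d p → ∀ b {i j} → i < d → j < d →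
                                (b + i * p) % d ≡ (b + j * p) % d → i ≡ j
  multiple-residues-injective d⊥p b {i} {j} i<d j<d eq with <-cmp i j
  ... | tri< i<j _ _ = contradiction eq (multiple-residues-distinct d⊥p b i<j j<d)
  ... | tri≈ _ i≡j _ = i≡j
  ... | tri> _ _ j<i = contradiction (sym eq) (multiple-residues-distinct d⊥p b j<i i<d)

toℕ%n≡toℕ : ∀ {d} .{{_ : NonZero d}} (v : Fin d) → toℕ v % d ≡ toℕ v
toℕ%n≡toℕ v = m<n⇒m%n≡m (toℕ<n v)

module ResidueColouring {q n : ℕ} .{{_ : NonZero q}} .{{_ : NonZero n}} (q∣n : q ∣ n)
  (a : Fin q → ℕ) (a≥1 : ∀ i → 1 ≤ a i) (2a<n : ∀ i → 2 * a i < n)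
  (a-residues-injective : Injective _≡_ _≡_ (λ i → a i % q)) where
  open ≡-Reasoning

  colour : Fin n → Fin q
  colour v = fromℕ< (m%n<n (toℕ v) q)

  colour≡⇒residue≡ : ∀ {v c} → colour v ≡ c → toℕ v % q ≡ toℕ c
  colour≡⇒residue≡ refl = sym (toℕ-fromℕ< _)

  residue≡⇒colour≡ : ∀ {v c} → toℕ v % q ≡ toℕ c → colour v ≡ c
  residue≡⇒colour≡ v≡c = toℕ-injective (trans (toℕ-fromℕ< _) v≡c)

  residue-%n : ∀ {v : Fin n} t → toℕ v ≡ t % n → toℕ v % q ≡ t % q
  residue-%n t v≡t = trans (cong (_% q) v≡t) (m∣n⇒o%n%m≡o%m q n t q∣n)

  shifted-residues-injective : ∀ t {i j} → (t + a i) % q ≡ (t + a j) % q → i ≡ j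
  shifted-residues-injective t = a-residues-injective ∘ +-cancelˡ-mod t

  shifted-residues-surjective : ∀ t (c : Fin q) → ∃[ i ] (t + a i) % q ≡ toℕ c
  shifted-residues-surjective t c =
    let i , shift-i≡c = injective⇒surjective shift-injective c
    in i , trans (sym (toℕ-fromℕ< _)) (cong toℕ shift-i≡c)
    where
    shift : Fin q → Fin q
    shift i = fromℕ< (m%n<n (t + a i) q)

    shift-injective : Injective _≡_ _≡_ shift
    shift-injective eq = shifted-residues-injective t
      (trans (sym (toℕ-fromℕ< _)) (trans (cong toℕ eq) (toℕ-fromℕ< _)))

  a≤n : ∀ i → a i ≤ n
  a≤n i = ≤-trans (m≤m+n (a i) (a i + 0)) (<⇒≤ (2a<n i))

  a+a<n : ∀ i j → a i + a j < n
  a+a<n i j = *-cancelˡ-< 2 (a i + a j) n (subst₂ _<_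
    (sym (*-distribˡ-+ 2 (a i) (a j))) (cong (n +_) (sym (+-identityʳ n)))
    (+-mono-< (2a<n i) (2a<n j)))

  module _ (u : Fin n) (c : Fin q) where
    private
      U = toℕ u
      i = proj₁ (shifted-residues-surjective U c)
      j = proj₁ (shifted-residues-surjective (toℕ c) (colour u))

      i-residue : (U + a i) % q ≡ toℕ c
      i-residue = proj₂ (shifted-residues-surjective U c)

      j-residue : (toℕ c + a j) % q ≡ U % q
      j-residue = trans (proj₂ (shifted-residues-surjective (toℕ c) (colour u))) (toℕ-fromℕ< _)

    forward : Fin n
    forward = fromℕ< (m%n<n (U + a i) n)

    backward : Fin n
    backward = fromℕ< (m%n<n (U + (n ∸ a j)) n)

    forward-jump : (U + a i) % n ≡ toℕ forward
    forward-jump = sym (toℕ-fromℕ< _)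

    backward-jump : (toℕ backward + a j) % n ≡ U
    backward-jump = begin
      (toℕ backward + a j) % n         ≡⟨ cong (λ t → (t + a j) % n) (toℕ-fromℕ< _) ⟩
      ((U + (n ∸ a j)) % n + a j) % n  ≡⟨ [[m+[d∸o]]%d+o]%d≡m%d U (a≤n j) ⟩
      U % n                            ≡⟨ toℕ%n≡toℕ u ⟩
      U                                ∎

    forward-colour : colour forward ≡ c
    forward-colour = residue≡⇒colour≡ (trans (residue-%n _ (toℕ-fromℕ< _)) i-residue)

    backward-colour : colour backward ≡ c
    backward-colour = residue≡⇒colour≡ (trans (+-cancelʳ-mod (a j) (begin
      (toℕ backward + a j) % q  ≡⟨ residue-%n _ (sym backward-jump) ⟨
      U % q                     ≡⟨ j-residue ⟨
      (toℕ c + a j) % q         ∎)) (toℕ%n≡toℕ c))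

    forward≢backward : forward ≢ backward
    forward≢backward f≡b = >⇒≢ (a≥1 i) (m+n≡0⇒m≡0 (a i) (begin
      a i + a j        ≡⟨ m<n⇒m%n≡m (a+a<n i j) ⟨
      (a i + a j) % n  ≡⟨ +-cancelˡ-mod U U+a+a≡U+0 ⟩
      0 % n            ≡⟨ m<n⇒m%n≡m (>-nonZero⁻¹ n) ⟩
      0                ∎))
      where
      U+a+a≡U+0 : (U + (a i + a j)) % n ≡ (U + 0) % n
      U+a+a≡U+0 = begin
        (U + (a i + a j)) % n        ≡⟨ cong (_% n) (+-assoc U (a i) (a j)) ⟨
        (U + a i + a j) % n          ≡⟨ +-congˡ-mod (a j) (m%n%n≡m%n (U + a i) n) ⟨
        ((U + a i) % n + a j) % n    ≡⟨ cong (λ t → (t + a j) % n) (trans forward-jump (cong toℕ f≡b)) ⟩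
        (toℕ backward + a j) % n     ≡⟨ backward-jump ⟩
        U                            ≡⟨ toℕ%n≡toℕ u ⟨
        U % n                        ≡⟨ cong (_% n) (+-identityʳ U) ⟨
        (U + 0) % n                  ∎

    only-forward-or-backward : ∀ v → T (circAdj n a u v) → colour v ≡ c →
                               v ≡ forward ⊎ v ≡ backward
    only-forward-or-backward v adj v-colour with circAdj⁻ n a u v adj
    ... | k , inj₁ u+k≡v = inj₁ (toℕ-injective (begin
      toℕ v            ≡⟨ u+k≡v ⟨
      (U + a k) % n    ≡⟨ cong (λ l → (U + a l) % n) i≡k ⟨
      (U + a i) % n    ≡⟨ forward-jump ⟩
      toℕ forward      ∎))
      where
      i≡k : i ≡ k
      i≡k = shifted-residues-injective U (trans i-residue
        (trans (sym (colour≡⇒residue≡ v-colour)) (residue-%n _ (sym u+k≡v))))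
    ... | k , inj₂ v+k≡u = inj₂ (toℕ-injective (begin
      toℕ v                     ≡⟨ toℕ%n≡toℕ v ⟨
      toℕ v % n                 ≡⟨ +-cancelʳ-mod (a j) (trans v+j≡u (sym backward-jump)) ⟩
      toℕ backward % n          ≡⟨ toℕ%n≡toℕ backward ⟩
      toℕ backward              ∎))
      where
      j≡k : j ≡ k
      j≡k = shifted-residues-injective (toℕ c) (begin
        (toℕ c + a j) % q  ≡⟨ j-residue ⟩
        U % q              ≡⟨ residue-%n _ (sym v+k≡u) ⟩
        (toℕ v + a k) % q  ≡⟨ +-congˡ-mod (a k)
                                (trans (colour≡⇒residue≡ v-colour) (sym (toℕ%n≡toℕ c))) ⟩
        (toℕ c + a k) % q  ∎)
      v+j≡u : (toℕ v + a j) % n ≡ U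
      v+j≡u = trans (cong (λ l → (toℕ v + a l) % n) j≡k) v+k≡u

    colour-count≡2 : nbrCount n a colour u c ≡ 2
    colour-count≡2 = begin
      nbrCount n a colour u c
        ≡⟨ length-filter-filter≡multiplicity+multiplicity _≟_
             (λ v → T? (circAdj n a u v)) (λ v → colour v ≟ c) forward≢backward
             (circAdj⁺ n a u forward i (inj₁ forward-jump) , forward-colour)
             (circAdj⁺ n a u backward j (inj₂ backward-jump) , backward-colour)
             only-forward-or-backward (allFin n) ⟩
      multiplicity _≟_ forward (allFin n) + multiplicity _≟_ backward (allFin n)
        ≡⟨ cong₂ _+_ (multiplicity-tabulate _≟_ id forward) (multiplicity-tabulate _≟_ id backward) ⟩
      2 ∎

  colour-balanced : IsNBColoring n a q colour
  colour-balanced u c c′ = trans (colour-count≡2 u c) (sym (colour-count≡2 u c′))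

4k+2≡2*[2k+1] : ∀ k → 4 * k + 2 ≡ 2 * suc (2 * k)
4k+2≡2*[2k+1] = solve-∀

theorem2p15 : (k : ℕ) → 1 ≤ k → Prime (suc (2 * k)) →
    (n : ℕ) .{{_ : NonZero n}} → (4 * k + 2) ∣ n →
    (a : Fin (suc (2 * k)) → ℕ) →
    (∀ i → 1 ≤ a i) → (∀ i j → i <ᶠ j → a i < a j) → (∀ i → 2 * a i < n) →
    (p : ℕ) → 1 ≤ p → p ≤ 2 * k →
    (∀ (i : Fin (2 * k)) → (a (fsuc i) ∸ a (inject₁ i)) % suc (2 * k) ≡ p) →
    AdmitsNBColoring n a (suc (2 * k))
theorem2p15 k _ q-prime n 4k+2∣n a a≥1 a-increasing 2a<n p p≥1 p≤2k steps =
  colour , colour-balanced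
  where
  q = suc (2 * k)

  residue : ∀ i → a i % q ≡ (a fzero + toℕ i * p) % q
  residue = arithmetic-progression-residue a
    (λ i → <⇒≤ (a-increasing (inject₁ i) (fsuc i) (≤̄⇒inject₁< ≤-refl)))
    (λ i → trans (steps i) (sym (m<n⇒m%n≡m (s≤s p≤2k))))

  residues-injective : Injective _≡_ _≡_ (λ i → a i % q)
  residues-injective {i} {j} eq = toℕ-injective (multiple-residues-injective
    (prime⇒coprime q-prime {{>-nonZero p≥1}} (s≤s p≤2k)) (a fzero) (toℕ<n i) (toℕ<n j)
    (trans (sym (residue i)) (trans eq (residue j))))

  q∣n : q ∣ n
  q∣n = ∣-trans (divides 2 (4k+2≡2*[2k+1] k)) 4k+2∣n

  open ResidueColouring q∣n a a≥1 2a<n residues-injective
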